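{- Let $\ell=p_1^{\alpha_1}\cdots p_\omega^{\alpha_\omega}$ be the prime factorization of a positive integer $\ell$ with $\omega$ distinct primes, let $n$ be a positive integer, and let $\mathcal{A}$ be an $\ell$-Oddtown on ground set $[n]$. For $i\in[\omega]$ let $\mathcal{A}_i=\{A\in\mathcal{A}: |A|\not\equiv 0\pmod{p_i^{\alpha_i}}\}$ and $\mathcal{A}_i'=\mathcal{A}\setminus\mathcal{A}_i$, and let $M_i$ be the $|\mathcal{A}_i'|\times n$ matrix whose rows are the characteristic vectors of the sets in $\mathcal{A}_i'$. Call an odd prime divisor $p_i$ of $\ell$ bad if $M_i$ has fewer than $n^{0.4}$ distinct columns. Then either at most one odd prime divisor of $\ell$ is bad, or \[ |\mathcal{A}|\le \omega n-n^{0.2}+\omega\ell . \]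
   Context: An $\ell$-Oddtown on ground set $[n]=\{1,\dots,n\}$ is a family $\mathcal{A}$ of subsets of $[n]$ such that $|A|\not\equiv 0\pmod{\ell}$ for every $A\in\mathcal{A}$ and $|A\cap B|\equiv 0\pmod{\ell}$ for all distinct $A,B\in\mathcal{A}$. -}

module Defs where

open import Data.Nat using (ℕ; zero; suc; _+_; _*_; _∸_; _^_; _≤_; _<_)
open import Data.Nat.Divisibility using (_∣_; _∣?_)
open import Data.Nat.Primality using (Prime)
open import Data.Bool using (Bool)
import Data.Bool as Bool
open import Data.Fin using (Fin; zero; suc)
open import Data.Fin.Subset using (Subset; _∩_; ∣_∣)
open import Data.Vec using (lookup)
open import Data.List using (List; length; map; filter; deduplicate; allFin)
open import Data.List.Properties using (≡-dec)
open import Data.List.Relation.Unary.All using (All)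
open import Data.List.Relation.Unary.AllPairs using (AllPairs)
open import Data.List.Relation.Unary.Unique.Propositional using (Unique)
open import Data.Product using (_×_)
open import Relation.Nullary using (¬_)
open import Relation.Binary.PropositionalEquality using (_≡_; _≢_)
open import Function.Definitions using (Injective)

∏ : (ω : ℕ) → (Fin ω → ℕ) → ℕ
∏ zero f = 1
∏ (suc ω) f = f zero * ∏ ω (λ i → f (suc i))

IsPrimeFactorization : ℕ → (ω : ℕ) → (Fin ω → ℕ) → (Fin ω → ℕ) → Set
IsPrimeFactorization ℓ ω p α =
  ((i : Fin ω) → Prime (p i)) × Injective _≡_ _≡_ p ×
  ((i : Fin ω) → 1 ≤ α i) × (ℓ ≡ ∏ ω (λ i → p i ^ α i))

IsOddtown : (ℓ n : ℕ) → List (Subset n) → Set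
IsOddtown ℓ n 𝒜 =
  Unique 𝒜 × All (λ A → ¬ (ℓ ∣ ∣ A ∣)) 𝒜 × AllPairs (λ A B → ℓ ∣ ∣ A ∩ B ∣) 𝒜

-- 𝒜ᵢ' = sets whose size is divisible by q = pᵢ^αᵢ (i.e. 𝒜 ∖ 𝒜ᵢ)
𝒜′ : {n : ℕ} → ℕ → List (Subset n) → List (Subset n)
𝒜′ q 𝒜 = filter (λ A → q ∣? ∣ A ∣) 𝒜

column : {n : ℕ} → List (Subset n) → Fin n → List Bool
column rows j = map (λ A → lookup A j) rows

distinctColumns : (n : ℕ) → List (Subset n) → ℕ
distinctColumns n rows =
  length (deduplicate (≡-dec Bool._≟_) (map (column rows) (allFin n)))

-- pᵢ is bad: pᵢ odd and Mᵢ has fewer than n^0.4 distinct columns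
-- (c < n^(2/5) ⇔ c^5 < n^2 for natural c)
Bad : (n : ℕ) → List (Subset n) → (p q : ℕ) → Set
Bad n 𝒜 p q = (p ≢ 2) × (distinctColumns n (𝒜′ q 𝒜) ^ 5 < n ^ 2)

-- |𝒜| ≤ ω n − n^0.2 + ω ℓ, i.e. k + n^(1/5) ≤ R with R = ωn + ωℓ,
-- equivalently k ≤ R and n ≤ (R − k)^5
Bound : (ω n ℓ k : ℕ) → Set
Bound ω n ℓ k = (k ≤ ω * n + ω * ℓ) × (n ≤ ((ω * n + ω * ℓ) ∸ k) ^ 5)

-- Suppose pᵢ ≠ pⱼ are both bad; only the column condition for pᵢ is used (oddness and n ≥ 1 are not).
-- For a prime power q = p ^ α the characteristic vectors of a q-Oddtown are linearly independent:
-- intersecting an integer relation ∑ c_k 1_{A_k} = 0 with A_b gives q ∣ c_b |A_b|, so p ∣ c_b for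
-- every b, and dividing the relation by p again and again forces c = 0. As Gaussian elimination
-- produces a relation once there are more sets than distinct columns, a q-Oddtown has at most as many
-- sets as its incidence matrix has distinct columns.
-- Since ℓ ∤ |A|, every A ∈ 𝒜 has some qₖ = pₖ ^ αₖ ∤ |A|; file A under such a k, using class j only
-- for sets of 𝒜ᵢ′. Class k is a qₖ-Oddtown, so it has at most n sets, and class j at most d, the number
-- of distinct columns of Mᵢ. Hence |𝒜| ≤ (ω − 1) n + d, and d < n ^ 0.4 turns this into the bound.

module Submission where

open import Defs
open import Data.Nat as ℕ using (ℕ; zero; suc; _<_; _≤_; s≤s; z≤n; _^_)
import Data.Nat.Properties as ℕP
open import Data.Nat.Divisibility as ℕD using (_∣_; _∣?_; divides)
open import Data.Nat.Primality
  using (Prime; euclidsLemma; prime⇒nonZero; prime⇒nonTrivial; prime⇒irreducible; ¬prime[1])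
import Data.Bool as Bool
open import Data.Fin using (Fin; zero; suc; punchIn)
import Data.Fin.Properties as FinP
open import Data.Fin.Subset using (Subset; _∩_; ∣_∣)
open import Data.Fin.Subset.Properties using (∩-comm)
open import Data.Vec using ([]; _∷_; lookup)
open import Data.List as List using (List; []; _∷_; length; map; filter; deduplicate; allFin)
open import Data.List.Properties using (≡-dec; ∷-injective)
open import Data.List.Relation.Unary.All as All using (All; _∷_)
open import Data.List.Relation.Unary.All.Properties using (all-filter)
open import Data.List.Relation.Unary.AllPairs as AllPairs using (AllPairs; _∷_)
import Data.List.Relation.Unary.AllPairs.Properties as AllPairsP
open import Data.List.Relation.Unary.Any as Any using (here; there)
open import Data.List.Relation.Unary.Any.Properties using (lookup-index)
open import Data.List.Membership.Propositional using (_∈_)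
open import Data.List.Membership.Propositional.Properties
  using (∈-lookup; ∈-allFin; ∈-map⁺; ∈-map⁻; ∈-deduplicate⁺; ∈-deduplicate⁻; ∈-filter⁺; ∈-filter⁻)
open import Data.List.Relation.Binary.Subset.Propositional using (_⊆_)
open import Data.Product using (Σ; ∃; ∃₂; _×_; _,_; proj₁; proj₂)
open import Data.Sum using (_⊎_; inj₁; inj₂)
open import Function using (_∘_)
open import Function.Definitions using (Injective)
open import Relation.Nullary using (¬_; ¬?; Dec; yes; no; contradiction)
open import Relation.Nullary.Decidable using (_×-dec_; _→-dec_; decidable-stable)
open import Relation.Unary using (Decidable)
open import Relation.Binary.PropositionalEquality

p^α∣m*n⇒p^α∣n : ∀ {p} → Prime p → ∀ α {m n} → ¬ p ∣ m → p ^ α ∣ m ℕ.* n → p ^ α ∣ n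
p^α∣m*n⇒p^α∣n p-prime zero p∤m _ = ℕD.1∣ _
p^α∣m*n⇒p^α∣n {p} p-prime (suc α) {m} {n} p∤m p^α⁺∣mn
  with euclidsLemma m n p-prime (ℕD.m*n∣⇒m∣ p (p ^ α) p^α⁺∣mn)
... | inj₁ p∣m = contradiction p∣m p∤m
... | inj₂ (divides n′ refl) =
  subst (_∣ n′ ℕ.* p) (ℕP.*-comm (p ^ α) p) (ℕD.*-monoˡ-∣ p p^α∣n′)
  where
  instance _ = prime⇒nonZero p-prime
  m*[n′*p]≡p*[m*n′] : m ℕ.* (n′ ℕ.* p) ≡ p ℕ.* (m ℕ.* n′)
  m*[n′*p]≡p*[m*n′] = trans (sym (ℕP.*-assoc m n′ p)) (ℕP.*-comm (m ℕ.* n′) p)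
  p^α∣n′ : p ^ α ∣ n′
  p^α∣n′ = p^α∣m*n⇒p^α∣n p-prime α p∤m
    (ℕD.*-cancelˡ-∣ p (subst (p ℕ.* p ^ α ∣_) m*[n′*p]≡p*[m*n′] p^α⁺∣mn))

n<m^n : ∀ {m} → 1 < m → ∀ n → n < m ^ n
n<m^n 1<m zero = s≤s z≤n
n<m^n {m} 1<m (suc n) = ℕP.≤-<-trans n<m^n′ (subst (m ^ n <_) (ℕP.*-comm (m ^ n) m) (ℕP.m<m*n (m ^ n) m 1<m))
  where
  n<m^n′ = n<m^n 1<m n
  instance _ = ℕ.>-nonZero (ℕP.m<n⇒0<n n<m^n′)

module IntegerLinearAlgebra where

  open import Data.Integer as ℤ using (ℤ; 0ℤ; 1ℤ; _+_; _*_; -_)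
  import Data.Integer.Properties as ℤP
  open import Data.Integer.Tactic.RingSolver using (solve-∀)
  import Data.Integer.Divisibility.Signed as ℤD
  open import Data.Vec.Functional using (Vector; insertAt; removeAt)
  open import Data.Vec.Functional.Properties using (insertAt-lookup; insertAt-punchIn)
  open import Algebra.Properties.Semiring.Sum ℤP.+-*-semiring

  _·_ : ∀ {m} → Vector ℤ m → Vector ℤ m → ℤ
  c · v = sum (λ k → c k * v k)

  ·-congʳ : ∀ {m} (c : Vector ℤ m) {u u′ : Vector ℤ m} → (∀ k → u k ≡ u′ k) → c · u ≡ c · u′
  ·-congʳ c u≗u′ = sum-cong-≗ (λ k → cong (c k *_) (u≗u′ k))

  ·-zeroʳ : ∀ {m} (c : Vector ℤ m) {v} → (∀ k → v k ≡ 0ℤ) → c · v ≡ 0ℤ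
  ·-zeroʳ {m} c v≗0 =
    trans (sum-cong-≗ (λ k → trans (cong (c k *_) (v≗0 k)) (ℤP.*-zeroʳ (c k)))) (sum-replicate-zero m)

  ·-scaleˡ : ∀ {m} a (c v : Vector ℤ m) → (λ k → a * c k) · v ≡ a * (c · v)
  ·-scaleˡ a c v =
    trans (sum-cong-≗ (λ k → ℤP.*-assoc a (c k) (v k))) (sym (*-distribˡ-sum a (λ k → c k * v k)))

  ·-linearʳ : ∀ {m} (c u w : Vector ℤ m) a b →
              c · (λ k → a * u k + b * w k) ≡ a * (c · u) + b * (c · w)
  ·-linearʳ c u w a b = begin
    c · (λ k → a * u k + b * w k)        ≡⟨ sum-cong-≗ (λ k → distrib (c k) (u k) (w k) a b) ⟩
    sum (λ k → a * cu k + b * cw k)      ≡⟨ ∑-distrib-+ (λ k → a * cu k) (λ k → b * cw k) ⟩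
    sum (λ k → a * cu k) + sum (λ k → b * cw k)
      ≡⟨ sym (cong₂ _+_ (*-distribˡ-sum a cu) (*-distribˡ-sum b cw)) ⟩
    a * (c · u) + b * (c · w)            ∎
    where
    open ≡-Reasoning
    cu = λ k → c k * u k
    cw = λ k → c k * w k
    distrib : ∀ x y z a b → x * (a * y + b * z) ≡ a * (x * y) + b * (x * z)
    distrib = solve-∀

  ∣-sum : ∀ {m} {d} (f : Vector ℤ m) → (∀ k → d ℤD.∣ f k) → d ℤD.∣ sum f
  ∣-sum {zero} f _ = ℤD.∣ᵤ⇒∣ (_ ℕD.∣0)
  ∣-sum {suc m} f d∣f = ℤD.∣m∣n⇒∣m+n (d∣f zero) (∣-sum (f ∘ suc) (d∣f ∘ suc))

  ∣-sum-except : ∀ {m} {d} (f : Vector ℤ m) b → (∀ k → k ≢ b → d ℤD.∣ f k) → d ℤD.∣ sum f → d ℤD.∣ f b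
  ∣-sum-except {suc m} f b d∣f d∣∑f = ℤD.∣m+n∣n⇒∣m (subst (_ ℤD.∣_) (sum-remove {i = b} f) d∣∑f)
    (∣-sum (removeAt f b) (λ k → d∣f (punchIn b k) (FinP.punchInᵢ≢i b k)))

  ·-insertAt : ∀ {m} (c : Vector ℤ m) j x (v : Vector ℤ (suc m)) →
               insertAt c j x · v ≡ x * v j + c · removeAt v j
  ·-insertAt c j x v = trans (sum-remove {i = j} (λ k → insertAt c j x k * v k))
    (cong₂ _+_ (cong (_* v j) (insertAt-lookup c j x))
               (sum-cong-≗ (λ k → cong (_* v (punchIn j k)) (insertAt-punchIn c j x k))))

  -- One step of Gaussian elimination with pivot M zero j: row 0 and column j are eliminated,
  -- and a solution of the smaller system is lifted back by solving row 0 for the pivot unknown.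
  eliminate : ∀ {d m} → (Fin (suc d) → Vector ℤ (suc m)) → Fin (suc m) → Fin d → Vector ℤ m
  eliminate M j t k = M zero j * removeAt (M (suc t)) j k + (- M (suc t) j) * removeAt (M zero) j k

  backSubstitute : ∀ {d m} → (Fin (suc d) → Vector ℤ (suc m)) → Fin (suc m) → Vector ℤ m → Vector ℤ (suc m)
  backSubstitute M j c = insertAt (λ k → M zero j * c k) j (- (c · removeAt (M zero) j))

  backSubstitute-solves : ∀ {d m} (M : Fin (suc d) → Vector ℤ (suc m)) j c →
    (∀ t → c · eliminate M j t ≡ 0ℤ) → ∀ t → backSubstitute M j c · M t ≡ 0ℤ
  backSubstitute-solves M j c solves zero = begin
    backSubstitute M j c · M zero         ≡⟨ ·-insertAt _ j _ (M zero) ⟩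
    - s * a + (λ k → a * c k) · r₀        ≡⟨ cong (_+_ (- s * a)) (·-scaleˡ a c r₀) ⟩
    - s * a + a * s                       ≡⟨ cancel s a ⟩
    0ℤ                                    ∎
    where
    open ≡-Reasoning
    a = M zero j
    r₀ = removeAt (M zero) j
    s = c · r₀
    cancel : ∀ s a → - s * a + a * s ≡ 0ℤ
    cancel = solve-∀
  backSubstitute-solves M j c solves (suc t) = begin
    backSubstitute M j c · M (suc t)      ≡⟨ ·-insertAt _ j _ (M (suc t)) ⟩
    - s * b + (λ k → a * c k) · r         ≡⟨ cong (_+_ (- s * b)) (·-scaleˡ a c r) ⟩
    - s * b + a * (c · r)                 ≡⟨ reorder s b a (c · r) ⟩
    a * (c · r) + (- b) * s               ≡⟨ sym (·-linearʳ c r (removeAt (M zero) j) a (- b)) ⟩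
    c · eliminate M j t                   ≡⟨ solves t ⟩
    0ℤ                                    ∎
    where
    open ≡-Reasoning
    a = M zero j
    b = M (suc t) j
    r = removeAt (M (suc t)) j
    s = c · removeAt (M zero) j
    reorder : ∀ s b a x → - s * b + a * x ≡ a * x + (- b) * s
    reorder = solve-∀

  backSubstitute-nonzero : ∀ {d m} (M : Fin (suc d) → Vector ℤ (suc m)) j c k →
    M zero j ≢ 0ℤ → c k ≢ 0ℤ → backSubstitute M j c (punchIn j k) ≢ 0ℤ
  backSubstitute-nonzero M j c k a≢0 cₖ≢0 eq
    with ℤP.i*j≡0⇒i≡0∨j≡0 (M zero j) (trans (sym (insertAt-punchIn _ j _ k)) eq)
  ... | inj₁ a≡0 = a≢0 a≡0
  ... | inj₂ cₖ≡0 = cₖ≢0 cₖ≡0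

  homogeneous-system-has-nonzero-solution : ∀ {d m} (M : Fin d → Vector ℤ m) → d < m →
    ∃ λ c → (∃ λ k → c k ≢ 0ℤ) × (∀ t → c · M t ≡ 0ℤ)
  homogeneous-system-has-nonzero-solution {zero} {suc m} M _ = (λ _ → 1ℤ) , (zero , λ ()) , λ ()
  homogeneous-system-has-nonzero-solution {suc d} {suc m} M (s≤s d<m)
    with FinP.all? (λ k → M zero k ℤP.≟ 0ℤ)
  ... | yes row₀≡0 =
    let c , nonzero , solves = homogeneous-system-has-nonzero-solution (M ∘ suc) (ℕP.m<n⇒m<1+n d<m)
    in c , nonzero , λ { zero → ·-zeroʳ c row₀≡0 ; (suc t) → solves t }
  ... | no row₀≢0 with FinP.¬∀⟶∃¬ (suc m) _ (λ k → M zero k ℤP.≟ 0ℤ) row₀≢0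
  ... | j , a≢0 with homogeneous-system-has-nonzero-solution (eliminate M j) d<m
  ... | c , (k , cₖ≢0) , solves =
    backSubstitute M j c , (punchIn j k , backSubstitute-nonzero M j c k a≢0 cₖ≢0) ,
    backSubstitute-solves M j c solves

module PrimePowerOddtown where

  open IntegerLinearAlgebra
  open import Data.Integer as ℤ using (ℤ; +_; 0ℤ; 1ℤ; _+_; _*_)
  import Data.Integer.Properties as ℤP
  import Data.Integer.Divisibility.Signed as ℤD
  open import Data.Bool using (Bool; true; false; _∧_)
  import Data.Vec.Properties as VecP
  open import Data.Vec.Functional using (Vector)
  open import Data.Fin.Subset.Properties using (∩-idem)
  open import Algebra.Properties.Semiring.Sum ℤP.+-*-semiring

  indicator : Bool → ℤ
  indicator true = 1ℤ
  indicator false = 0ℤ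

  indicator-∧ : ∀ a b → indicator (a ∧ b) ≡ indicator a * indicator b
  indicator-∧ true true = refl
  indicator-∧ true false = refl
  indicator-∧ false true = refl
  indicator-∧ false false = refl

  χ : ∀ {n} → Subset n → Vector ℤ n
  χ A x = indicator (lookup A x)

  ∣A∣≡∑χ : ∀ {n} (A : Subset n) → + ∣ A ∣ ≡ sum (χ A)
  ∣A∣≡∑χ [] = refl
  ∣A∣≡∑χ (true ∷ A) = cong (_+_ 1ℤ) (∣A∣≡∑χ A)
  ∣A∣≡∑χ (false ∷ A) = trans (∣A∣≡∑χ A) (sym (ℤP.+-identityˡ _))

  ∣A∩B∣≡χ·χ : ∀ {n} (A B : Subset n) → + ∣ A ∩ B ∣ ≡ χ A · χ B
  ∣A∩B∣≡χ·χ A B = trans (∣A∣≡∑χ (A ∩ B))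
    (sum-cong-≗ (λ x → trans (cong indicator (VecP.lookup-zipWith _∧_ x A B))
                             (indicator-∧ (lookup A x) (lookup B x))))

  IsLinearRelation : ∀ {m n} → (Fin m → Subset n) → Vector ℤ m → Set
  IsLinearRelation A c = ∀ x → c · (λ k → χ (A k) x) ≡ 0ℤ

  linearRelation-on-intersections : ∀ {m n} (A : Fin m → Subset n) c → IsLinearRelation A c →
    ∀ b → c · (λ k → + ∣ A k ∩ A b ∣) ≡ 0ℤ
  linearRelation-on-intersections {m} {n} A c relation b = begin
    c · (λ k → + ∣ A k ∩ A b ∣)
        ≡⟨ ·-congʳ c (λ k → ∣A∩B∣≡χ·χ (A k) (A b)) ⟩
    sum (λ k → c k * sum (λ x → χ (A k) x * χ (A b) x))
        ≡⟨ sum-cong-≗ (λ k → *-distribˡ-sum (c k) (λ x → χ (A k) x * χ (A b) x)) ⟩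
    sum (λ k → sum (λ x → c k * (χ (A k) x * χ (A b) x)))
        ≡⟨ ∑-comm (λ k x → c k * (χ (A k) x * χ (A b) x)) ⟩
    sum (λ x → sum (λ k → c k * (χ (A k) x * χ (A b) x)))
        ≡⟨ sum-cong-≗ (λ x → trans (sum-cong-≗ (λ k → sym (ℤP.*-assoc (c k) _ _)))
                                   (sym (*-distribʳ-sum (χ (A b) x) (λ k → c k * χ (A k) x)))) ⟩
    sum (λ x → (c · (λ k → χ (A k) x)) * χ (A b) x)
        ≡⟨ sum-cong-≗ (λ x → trans (cong (_* χ (A b) x) (relation x)) (ℤP.*-zeroˡ (χ (A b) x))) ⟩
    sum {n} (λ _ → 0ℤ)                             ≡⟨ sum-replicate-zero n ⟩
    0ℤ                                             ∎
    where open ≡-Reasoning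

  module _ {p α m n} (p-prime : Prime p) (A : Fin m → Subset n)
           (size : ∀ k → ¬ p ^ α ∣ ∣ A k ∣)
           (intersection : ∀ k b → k ≢ b → p ^ α ∣ ∣ A k ∩ A b ∣) where

    p∣linearRelation : ∀ c → IsLinearRelation A c → ∀ b → p ∣ ℤ.∣ c b ∣
    p∣linearRelation c relation b with p ℕD.∣? ℤ.∣ c b ∣
    ... | yes p∣cb = p∣cb
    ... | no p∤cb = contradiction (p^α∣m*n⇒p^α∣n p-prime α p∤cb p^α∣cb*∣Ab∣) (size b)
      where
      -- all terms of the vanishing sum c · (|A k ∩ A b|)ₖ but the b-th are divisible by p ^ α
      p^α∣bth-term : + (p ^ α) ℤD.∣ c b * + ∣ A b ∩ A b ∣
      p^α∣bth-term = ∣-sum-except (λ k → c k * + ∣ A k ∩ A b ∣) b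
        (λ k k≢b → ℤD.∣n⇒∣m*n (c k) (ℤD.∣ᵤ⇒∣ (intersection k b k≢b)))
        (subst (+ (p ^ α) ℤD.∣_) (sym (linearRelation-on-intersections A c relation b))
               (ℤD.∣ᵤ⇒∣ (_ ℕD.∣0)))
      p^α∣cb*∣Ab∣ : p ^ α ∣ ℤ.∣ c b ∣ ℕ.* ∣ A b ∣
      p^α∣cb*∣Ab∣ = subst (p ^ α ∣_)
        (trans (ℤP.abs-* (c b) (+ ∣ A b ∩ A b ∣)) (cong (λ B → ℤ.∣ c b ∣ ℕ.* ∣ B ∣) (∩-idem (A b))))
        (ℤD.∣⇒∣ᵤ p^α∣bth-term)

    linearRelation-divided-by-p : ∀ c → IsLinearRelation A c →
      ∃ λ c′ → IsLinearRelation A c′ × (∀ k → ℤ.∣ c k ∣ ≡ p ℕ.* ℤ.∣ c′ k ∣)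
    linearRelation-divided-by-p c relation = c′ , relation′ , abs-c
      where
      p∣c : ∀ k → + p ℤD.∣ c k
      p∣c k = ℤD.∣ᵤ⇒∣ (p∣linearRelation c relation k)
      c′ : Vector ℤ m
      c′ k = ℤD.quotient (p∣c k)
      c≡p*c′ : ∀ k → c k ≡ + p * c′ k
      c≡p*c′ k = trans (ℤD._∣_.equality (p∣c k)) (ℤP.*-comm (c′ k) (+ p))
      abs-c : ∀ k → ℤ.∣ c k ∣ ≡ p ℕ.* ℤ.∣ c′ k ∣
      abs-c k = trans (cong ℤ.∣_∣ (c≡p*c′ k)) (ℤP.abs-* (+ p) (c′ k))
      p*[c′·χ]≡0 : ∀ x → + p * (c′ · (λ k → χ (A k) x)) ≡ 0ℤ
      p*[c′·χ]≡0 x = begin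
        + p * (c′ · (λ k → χ (A k) x))     ≡⟨ sym (·-scaleˡ (+ p) c′ (λ k → χ (A k) x)) ⟩
        (λ k → + p * c′ k) · (λ k → χ (A k) x)
                                           ≡⟨ sum-cong-≗ (λ k → cong (_* χ (A k) x) (sym (c≡p*c′ k))) ⟩
        c · (λ k → χ (A k) x)              ≡⟨ relation x ⟩
        0ℤ                                 ∎
        where open ≡-Reasoning
      relation′ : IsLinearRelation A c′
      relation′ x with ℤP.i*j≡0⇒i≡0∨j≡0 (+ p) (p*[c′·χ]≡0 x)
      ... | inj₁ p≡0 = contradiction (ℤP.+-injective p≡0) (ℕ.≢-nonZero⁻¹ p {{prime⇒nonZero p-prime}})
      ... | inj₂ c′·χ≡0 = c′·χ≡0

    p^e∣linearRelation : ∀ e c → IsLinearRelation A c → ∀ b → p ^ e ∣ ℤ.∣ c b ∣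
    p^e∣linearRelation zero c relation b = ℕD.1∣ _
    p^e∣linearRelation (suc e) c relation b with linearRelation-divided-by-p c relation
    ... | c′ , relation′ , ∣c∣≡p*∣c′∣ =
      subst (p ℕ.* p ^ e ∣_) (sym (∣c∣≡p*∣c′∣ b))
            (ℕD.*-monoʳ-∣ p (p^e∣linearRelation e c′ relation′ b))

    linearRelation≡0 : ∀ c → IsLinearRelation A c → ∀ b → c b ≡ 0ℤ
    linearRelation≡0 c relation b with ℤ.∣ c b ∣ in ∣cb∣≡
    ... | zero = ℤP.∣i∣≡0⇒i≡0 ∣cb∣≡
    ... | suc k = contradiction
      (ℕD.∣⇒≤ (subst (p ^ suc k ∣_) ∣cb∣≡ (p^e∣linearRelation (suc k) c relation b)))
      (ℕP.<⇒≱ (n<m^n (ℕ.nonTrivial⇒n>1 p {{prime⇒nonTrivial p-prime}}) (suc k)))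

    size-≤-columnCover : ∀ {r} (R : Fin r → Fin n) →
      (∀ x → ∃ λ t → ∀ k → lookup (A k) x ≡ lookup (A k) (R t)) → m ≤ r
    size-≤-columnCover {r} R cover with m ℕP.≤? r
    ... | yes m≤r = m≤r
    ... | no m≰r with homogeneous-system-has-nonzero-solution (λ t k → χ (A k) (R t)) (ℕP.≰⇒> m≰r)
    ... | c , (k , cₖ≢0) , solves = contradiction (linearRelation≡0 c relation k) cₖ≢0
      where
      relation : IsLinearRelation A c
      relation x with cover x
      ... | t , sameColumn = trans (·-congʳ c (λ k → cong indicator (sameColumn k))) (solves t)

open PrimePowerOddtown using (size-≤-columnCover)

AllPairs-lookup : ∀ {a r} {X : Set a} {R : X → X → Set r} → (∀ {x y} → R x y → R y x) →
  ∀ {xs} → AllPairs R xs → ∀ k b → k ≢ b → R (List.lookup xs k) (List.lookup xs b)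
AllPairs-lookup sym-R (_ ∷ _) zero zero k≢b = contradiction refl k≢b
AllPairs-lookup sym-R (Rx ∷ _) zero (suc b) _ = All.lookup Rx (∈-lookup b)
AllPairs-lookup sym-R (Rx ∷ _) (suc k) zero _ = sym-R (All.lookup Rx (∈-lookup k))
AllPairs-lookup sym-R (_ ∷ Rxs) (suc k) (suc b) k≢b = AllPairs-lookup sym-R Rxs k b (k≢b ∘ cong suc)

ColumnCover : ∀ {n r} → List (Subset n) → (Fin r → Fin n) → Set
ColumnCover S R = ∀ x → ∃ λ t → ∀ {A} → A ∈ S → lookup A x ≡ lookup A (R t)

ColumnCover-⊆ : ∀ {n r} {S T : List (Subset n)} {R : Fin r → Fin n} → S ⊆ T → ColumnCover T R → ColumnCover S R
ColumnCover-⊆ S⊆T cover x with cover x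
... | t , sameColumn = t , sameColumn ∘ S⊆T

ColumnCover-id : ∀ {n} (S : List (Subset n)) → ColumnCover S (λ x → x)
ColumnCover-id S x = x , λ _ → refl

column-≡⇒lookup-≡ : ∀ {n} {rows : List (Subset n)} {x y} → column rows x ≡ column rows y →
  ∀ {A} → A ∈ rows → lookup A x ≡ lookup A y
column-≡⇒lookup-≡ eq (here refl) = proj₁ (∷-injective eq)
column-≡⇒lookup-≡ eq (there A∈rows) = column-≡⇒lookup-≡ (proj₂ (∷-injective eq)) A∈rows

distinctColumns-cover : ∀ {n} (rows : List (Subset n)) →
  Σ (Fin (distinctColumns n rows) → Fin n) (ColumnCover rows)
distinctColumns-cover {n} rows = R , cover
  where
  columns = map (column rows) (allFin n)
  distinct = deduplicate (≡-dec Bool._≟_) columns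
  representative : ∀ t → ∃ λ x → List.lookup distinct t ≡ column rows x
  representative t with ∈-map⁻ (column rows) (∈-deduplicate⁻ (≡-dec Bool._≟_) columns (∈-lookup t))
  ... | x , _ , eq = x , eq
  R : Fin (length distinct) → Fin n
  R t = proj₁ (representative t)
  cover : ColumnCover rows R
  cover x = t , column-≡⇒lookup-≡ (trans (lookup-index x∈) (proj₂ (representative t)))
    where
    x∈ = ∈-deduplicate⁺ (≡-dec Bool._≟_) (∈-map⁺ (column rows) (∈-allFin x))
    t = Any.index x∈

primePowerOddtown-length-≤-cover : ∀ {p α n r} → Prime p → {S : List (Subset n)} →
  All (λ A → ¬ p ^ α ∣ ∣ A ∣) S → AllPairs (λ A B → p ^ α ∣ ∣ A ∩ B ∣) S →
  (R : Fin r → Fin n) → ColumnCover S R → length S ≤ r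
primePowerOddtown-length-≤-cover {p} {α} p-prime {S} sizes intersections R cover =
  size-≤-columnCover {α = α} p-prime (List.lookup S) (λ k → All.lookup sizes (∈-lookup k))
    (AllPairs-lookup (λ {A} {B} → subst (λ C → p ^ α ∣ ∣ C ∣) (∩-comm A B)) intersections)
    R (λ x → let t , sameColumn = cover x in t , λ k → sameColumn (∈-lookup k))

∣∏ : ∀ ω (f : Fin ω → ℕ) k → f k ∣ ∏ ω f
∣∏ (suc ω) f zero = ℕD.m∣m*n (∏ ω (f ∘ suc))
∣∏ (suc ω) f (suc k) = ℕD.∣n⇒∣m*n (f zero) (∣∏ ω (f ∘ suc) k)

prime∤1 : ∀ {r} → Prime r → ¬ r ∣ 1
prime∤1 r-prime r∣1 = ¬prime[1] (subst Prime (ℕD.∣1⇒≡1 r∣1) r-prime)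

prime∣m^n⇒prime∣m : ∀ {r m} → Prime r → ∀ n → r ∣ m ^ n → r ∣ m
prime∣m^n⇒prime∣m r-prime zero r∣1 = contradiction r∣1 (prime∤1 r-prime)
prime∣m^n⇒prime∣m {m = m} r-prime (suc n) r∣m^n with euclidsLemma m (m ^ n) r-prime r∣m^n
... | inj₁ r∣m = r∣m
... | inj₂ r∣m^n′ = prime∣m^n⇒prime∣m r-prime n r∣m^n′

prime∤∏-otherPrimePowers : ∀ {r} → Prime r → ∀ w (p α : Fin w → ℕ) → (∀ s → Prime (p s)) →
  (∀ s → r ≢ p s) → ¬ r ∣ ∏ w (λ s → p s ^ α s)
prime∤∏-otherPrimePowers r-prime zero p α primes r≢p = prime∤1 r-prime
prime∤∏-otherPrimePowers r-prime (suc w) p α primes r≢p r∣∏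
  with euclidsLemma (p zero ^ α zero) _ r-prime r∣∏
... | inj₂ r∣∏′ = prime∤∏-otherPrimePowers r-prime w (p ∘ suc) (α ∘ suc) (primes ∘ suc) (r≢p ∘ suc) r∣∏′
... | inj₁ r∣p₀^α₀ with prime⇒irreducible (primes zero) (prime∣m^n⇒prime∣m r-prime (α zero) r∣p₀^α₀)
...   | inj₁ r≡1 = ¬prime[1] (subst Prime r≡1 r-prime)
...   | inj₂ r≡p₀ = r≢p zero r≡p₀

∏∣ : ∀ ω (p α : Fin ω → ℕ) → (∀ i → Prime (p i)) → Injective _≡_ _≡_ p →
  ∀ {x} → (∀ i → p i ^ α i ∣ x) → ∏ ω (λ i → p i ^ α i) ∣ x
∏∣ zero p α primes injective _ = ℕD.1∣ _
∏∣ (suc ω) p α primes injective q∣x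
  with ∏∣ ω (p ∘ suc) (α ∘ suc) (primes ∘ suc) (FinP.suc-injective ∘ injective) (q∣x ∘ suc)
... | divides y refl = ℕD.*-monoˡ-∣ rest (p^α∣m*n⇒p^α∣n (primes zero) (α zero) p₀∤rest q₀∣rest*y)
  where
  rest = ∏ ω (λ i → p (suc i) ^ α (suc i))
  p₀∤rest : ¬ p zero ∣ rest
  p₀∤rest = prime∤∏-otherPrimePowers (primes zero) ω (p ∘ suc) (α ∘ suc) (primes ∘ suc)
    (λ s p₀≡pₛ → contradiction (injective p₀≡pₛ) λ ())
  q₀∣rest*y : p zero ^ α zero ∣ rest ℕ.* y
  q₀∣rest*y = subst (p zero ^ α zero ∣_) (ℕP.*-comm y rest) (q∣x zero)

module Counting where

  open import Data.Nat using (_+_; _*_; _∸_)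
  open import Data.Nat.Tactic.RingSolver using (solve-∀)
  open import Data.Bool using (true; false; if_then_else_)
  open import Relation.Nullary using (does)
  open import Data.Vec.Functional using (removeAt)
  open import Algebra.Properties.Semiring.Sum ℕP.+-*-semiring using (sum; sum-remove; sum-cong-≗; ∑-distrib-+)
  open ℕP.≤-Reasoning

  term-≤-sum : ∀ {m} (f : Fin m → ℕ) k → f k ≤ sum f
  term-≤-sum f zero = ℕP.m≤m+n (f zero) _
  term-≤-sum f (suc k) = ℕP.≤-trans (term-≤-sum (f ∘ suc) k) (ℕP.m≤n+m _ (f zero))

  sum-≤-* : ∀ {m b} (f : Fin m → ℕ) → (∀ k → f k ≤ b) → sum f ≤ m * b
  sum-≤-* {zero} f _ = z≤n
  sum-≤-* {suc m} f f≤b = ℕP.+-mono-≤ (f≤b zero) (sum-≤-* (f ∘ suc) (f≤b ∘ suc))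

  length-filter-∷ : ∀ {a p} {X : Set a} {P : X → Set p} (P? : Decidable P) x xs →
    length (filter P? (x ∷ xs)) ≡ (if does (P? x) then 1 else 0) + length (filter P? xs)
  length-filter-∷ P? x xs with does (P? x)
  ... | true = refl
  ... | false = refl

  length-≤-∑-filter : ∀ {a p} {X : Set a} {ω} {P : Fin ω → X → Set p} (P? : ∀ k → Decidable (P k)) xs →
    (∀ {x} → x ∈ xs → ∃ λ k → P k x) → length xs ≤ sum (λ k → length (filter (P? k) xs))
  length-≤-∑-filter P? [] _ = z≤n
  length-≤-∑-filter {ω = ω} P? (x ∷ xs) covered with covered (here refl)
  ... | k , Pkx = begin
    suc (length xs)
      ≤⟨ s≤s (length-≤-∑-filter P? xs (covered ∘ there)) ⟩
    1 + sum (λ k → length (filter (P? k) xs))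
      ≤⟨ ℕP.+-monoˡ-≤ _ (ℕP.≤-trans 1≤ind (term-≤-sum ind k)) ⟩
    sum ind + sum (λ k → length (filter (P? k) xs))
      ≡⟨ sym (∑-distrib-+ ind _) ⟩
    sum (λ k → ind k + length (filter (P? k) xs))
      ≡⟨ sym (sum-cong-≗ (λ k → length-filter-∷ (P? k) x xs)) ⟩
    sum (λ k → length (filter (P? k) (x ∷ xs)))
      ∎
    where
    ind : Fin ω → ℕ
    ind k = if does (P? k x) then 1 else 0
    1≤ind : 1 ≤ ind k
    1≤ind with P? k x
    ... | yes _ = ℕP.≤-refl
    ... | no ¬Pkx = contradiction Pkx ¬Pkx

  sum+n≤ : ∀ {ω n} (t : Fin ω → ℕ) j → (∀ k → k ≢ j → t k ≤ n) → sum t + n ≤ ω * n + t j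
  sum+n≤ {suc ω} {n} t j t≤n = begin
    sum t + n                          ≡⟨ cong (_+ n) (sum-remove {i = j} t) ⟩
    t j + sum (removeAt t j) + n       ≤⟨ ℕP.+-monoˡ-≤ n (ℕP.+-monoʳ-≤ (t j) rest≤) ⟩
    t j + ω * n + n                    ≡⟨ reorder (t j) (ω * n) n ⟩
    n + ω * n + t j                    ∎
    where
    rest≤ : sum (removeAt t j) ≤ ω * n
    rest≤ = sum-≤-* (removeAt t j) (λ k → t≤n (punchIn j k) (FinP.punchInᵢ≢i j k))
    reorder : ∀ a b c → a + b + c ≡ c + b + a
    reorder = solve-∀

module BoundArithmetic where

  open import Data.Nat using (_+_; _*_; _∸_)
  open import Data.Nat.Tactic.RingSolver using (solve-∀)
  open import Algebra.Properties.CommutativeSemiring.Exp ℕP.+-*-commutativeSemiring using (^-distrib-*)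
  open ℕP.≤-Reasoning

  m≤m^[1+k] : ∀ m k → m ≤ m ^ suc k
  m≤m^[1+k] zero k = z≤n
  m≤m^[1+k] (suc m) k = ℕP.m≤m*n (suc m) (suc m ^ k) {{ℕP.m^n≢0 (suc m) k}}

  d^5<n^2⇒d≤n : ∀ {d n} → d ^ 5 < n ^ 2 → d ≤ n
  d^5<n^2⇒d≤n {d} {n} d^5<n^2 with d ℕP.≤? n
  ... | yes d≤n = d≤n
  ... | no d≰n = contradiction d^5<n^2 (ℕP.≤⇒≯ (begin
    n ^ 2        ≤⟨ n^2≤n^5 n ⟩
    n ^ 5        ≤⟨ ℕP.^-monoˡ-≤ 5 (ℕP.<⇒≤ (ℕP.≰⇒> d≰n)) ⟩
    d ^ 5        ∎))
    where
    n^2≤n^5 : ∀ n → n ^ 2 ≤ n ^ 5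
    n^2≤n^5 zero = z≤n
    n^2≤n^5 (suc n) = ℕP.^-monoʳ-≤ (suc n) {2} {5} (s≤s (s≤s z≤n))

  -- with n = d + e and d ≥ 1 one has n ≤ (1 + e) d, so n ^ 5 ≤ (1 + e) ^ 5 d ^ 5 < (1 + e) ^ 5 n ^ 2
  d+e≤[1+e]^5 : ∀ d e → d ^ 5 < (d + e) ^ 2 → d + e ≤ suc e ^ 5
  d+e≤[1+e]^5 zero e _ = ℕP.≤-trans (ℕP.n≤1+n e) (m≤m^[1+k] (suc e) 4)
  d+e≤[1+e]^5 d@(suc d′) e d^5<n^2 = begin
    n        ≤⟨ m≤m^[1+k] n 2 ⟩
    n ^ 3    <⟨ ℕP.*-cancelˡ-< (n ^ 2) (n ^ 3) (s ^ 5) n^2*n^3<n^2*s^5 ⟩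
    s ^ 5    ∎
    where
    n = d + e
    s = suc e
    n≤s*d : n ≤ s * d
    n≤s*d = subst (n ≤_) (expand d′ e) (ℕP.m≤m+n n (e * d′))
      where
      expand : ∀ d′ e → suc d′ + e + e * d′ ≡ suc e * suc d′
      expand = solve-∀
    n^2*n^3<n^2*s^5 : n ^ 2 * n ^ 3 < n ^ 2 * s ^ 5
    n^2*n^3<n^2*s^5 = begin-strict
      n ^ 2 * n ^ 3     ≡⟨ sym (ℕP.^-distribˡ-+-* n 2 3) ⟩
      n ^ 5             ≤⟨ ℕP.^-monoˡ-≤ 5 n≤s*d ⟩
      (s * d) ^ 5       ≡⟨ ^-distrib-* s d 5 ⟩
      s ^ 5 * d ^ 5     <⟨ ℕP.*-monoʳ-< (s ^ 5) {{ℕP.m^n≢0 s 5}} d^5<n^2 ⟩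
      s ^ 5 * n ^ 2     ≡⟨ ℕP.*-comm (s ^ 5) (n ^ 2) ⟩
      n ^ 2 * s ^ 5     ∎

  bound-from-columnCount : ∀ ω n ℓ k d → 1 ≤ ω * ℓ → d ^ 5 < n ^ 2 → k + n ≤ ω * n + d → Bound ω n ℓ k
  bound-from-columnCount ω n ℓ k d 1≤ωℓ d^5<n^2 k+n≤ωn+d = k≤R , n≤[R∸k]^5
    where
    R = ω * n + ω * ℓ
    e = n ∸ d
    d+e≡n : d + e ≡ n
    d+e≡n = ℕP.m+[n∸m]≡n (d^5<n^2⇒d≤n {d} d^5<n^2)
    k+e≤ωn : k + e ≤ ω * n
    k+e≤ωn = ℕP.+-cancelʳ-≤ d (k + e) (ω * n) (begin
      k + e + d      ≡⟨ ℕP.+-assoc k e d ⟩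
      k + (e + d)    ≡⟨ cong (k +_) (trans (ℕP.+-comm e d) d+e≡n) ⟩
      k + n          ≤⟨ k+n≤ωn+d ⟩
      ω * n + d      ∎)
    k≤R : k ≤ R
    k≤R = begin
      k              ≤⟨ ℕP.m≤m+n k e ⟩
      k + e          ≤⟨ k+e≤ωn ⟩
      ω * n          ≤⟨ ℕP.m≤m+n (ω * n) (ω * ℓ) ⟩
      R              ∎
    1+e≤R∸k : suc e ≤ R ∸ k
    1+e≤R∸k = ℕP.m+n≤o⇒m≤o∸n (suc e) (begin
      suc e + k      ≡⟨ cong suc (ℕP.+-comm e k) ⟩
      suc (k + e)    ≤⟨ s≤s k+e≤ωn ⟩
      1 + ω * n      ≡⟨ ℕP.+-comm 1 (ω * n) ⟩
      ω * n + 1      ≤⟨ ℕP.+-monoʳ-≤ (ω * n) 1≤ωℓ ⟩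
      R              ∎)
    n≤[R∸k]^5 : n ≤ (R ∸ k) ^ 5
    n≤[R∸k]^5 = begin
      n              ≡⟨ sym d+e≡n ⟩
      d + e          ≤⟨ d+e≤[1+e]^5 d e (subst (λ m → d ^ 5 < m ^ 2) (sym d+e≡n) d^5<n^2) ⟩
      suc e ^ 5      ≤⟨ ℕP.^-monoˡ-≤ 5 1+e≤R∸k ⟩
      (R ∸ k) ^ 5    ∎

open Counting using (length-≤-∑-filter; sum+n≤)
open BoundArithmetic using (bound-from-columnCount)

unique-or-twoDistinct : ∀ {ω p} {P : Fin ω → Set p} → Decidable P →
  (∀ i j → P i → P j → i ≡ j) ⊎ ∃₂ λ i j → i ≢ j × P i × P j
unique-or-twoDistinct P? with FinP.any? (λ i → FinP.any? (λ j → ¬? (i FinP.≟ j) ×-dec P? i ×-dec P? j))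
... | yes (i , j , twoDistinct) = inj₂ (i , j , twoDistinct)
... | no ¬twoDistinct = inj₁ λ i j Pi Pj →
  decidable-stable (i FinP.≟ j) λ i≢j → ¬twoDistinct (i , j , i≢j , Pi , Pj)

Bad? : ∀ n 𝒜 p q → Dec (Bad n 𝒜 p q)
Bad? n 𝒜 p q = ¬? (p ℕP.≟ 2) ×-dec (_ ℕP.<? _)

module _ {ℓ ω} {p α : Fin ω → ℕ} (primes : ∀ i → Prime (p i)) (p-injective : Injective _≡_ _≡_ p)
         (ℓ≡∏ : ℓ ≡ ∏ ω (λ i → p i ^ α i)) {n} {𝒜 : List (Subset n)}
         (ℓ∤size : All (λ A → ¬ ℓ ∣ ∣ A ∣) 𝒜)
         (ℓ∣intersection : AllPairs (λ A B → ℓ ∣ ∣ A ∩ B ∣) 𝒜) where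

  private
    q : Fin ω → ℕ
    q k = p k ^ α k

    q∣ℓ : ∀ k → q k ∣ ℓ
    q∣ℓ k = subst (q k ∣_) (sym ℓ≡∏) (∣∏ ω q k)

  q∤size : ∀ {A} → A ∈ 𝒜 → ∃ λ k → ¬ q k ∣ ∣ A ∣
  q∤size {A} A∈𝒜 with FinP.all? (λ k → q k ∣? ∣ A ∣)
  ... | yes q∣size =
    contradiction (subst (_∣ ∣ A ∣) (sym ℓ≡∏) (∏∣ ω p α primes p-injective q∣size)) (All.lookup ℓ∤size A∈𝒜)
  ... | no ¬q∣size = FinP.¬∀⟶∃¬ ω _ (λ k → q k ∣? ∣ A ∣) ¬q∣size

  module _ {i j : Fin ω} (i≢j : i ≢ j) where

    Class : Fin ω → Subset n → Set
    Class k A = ¬ q k ∣ ∣ A ∣ × (k ≡ j → q i ∣ ∣ A ∣)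

    class? : ∀ k → Decidable (Class k)
    class? k A = ¬? (q k ∣? ∣ A ∣) ×-dec (k FinP.≟ j →-dec q i ∣? ∣ A ∣)

    classOf : ∀ {A} → A ∈ 𝒜 → ∃ λ k → Class k A
    classOf {A} A∈𝒜 with q∤size A∈𝒜
    ... | k , qₖ∤ with k FinP.≟ j
    ...   | no k≢j = k , qₖ∤ , λ k≡j → contradiction k≡j k≢j
    ...   | yes refl with q i ∣? ∣ A ∣
    ...     | yes qᵢ∣ = j , qₖ∤ , λ _ → qᵢ∣
    ...     | no qᵢ∤ = i , qᵢ∤ , λ i≡j → contradiction i≡j i≢j

    classSize : Fin ω → ℕ
    classSize k = length (filter (class? k) 𝒜)

    classSize-≤-cover : ∀ k {r} (R : Fin r → Fin n) → ColumnCover (filter (class? k) 𝒜) R → classSize k ≤ r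
    classSize-≤-cover k = primePowerOddtown-length-≤-cover {α = α k} (primes k)
      (All.map proj₁ (all-filter (class? k) 𝒜))
      (AllPairsP.filter⁺ (class? k) (AllPairs.map (ℕD.∣-trans (q∣ℓ k)) ℓ∣intersection))

    classSize-≤-n : ∀ k → classSize k ≤ n
    classSize-≤-n k = classSize-≤-cover k (λ x → x) (ColumnCover-id _)

    classSize-j-≤-distinctColumns : classSize j ≤ distinctColumns n (𝒜′ (q i) 𝒜)
    classSize-j-≤-distinctColumns with distinctColumns-cover (𝒜′ (q i) 𝒜)
    ... | R , cover = classSize-≤-cover j R (ColumnCover-⊆ class-j⊆𝒜ᵢ′ cover)
      where
      class-j⊆𝒜ᵢ′ : filter (class? j) 𝒜 ⊆ 𝒜′ (q i) 𝒜
      class-j⊆𝒜ᵢ′ A∈ with ∈-filter⁻ (class? j) {xs = 𝒜} A∈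
      ... | A∈𝒜 , _ , qᵢ∣ = ∈-filter⁺ (λ A → q i ∣? ∣ A ∣) {xs = 𝒜} A∈𝒜 (qᵢ∣ refl)

    length+n≤ : length 𝒜 ℕ.+ n ≤ ω ℕ.* n ℕ.+ distinctColumns n (𝒜′ (q i) 𝒜)
    length+n≤ = ℕP.≤-trans (ℕP.+-monoˡ-≤ n (length-≤-∑-filter class? 𝒜 classOf))
      (ℕP.≤-trans (sum+n≤ classSize j (λ k _ → classSize-≤-n k))
                  (ℕP.+-monoʳ-≤ (ω ℕ.* n) classSize-j-≤-distinctColumns))

lemma3p2 : (ℓ ω : ℕ) (p α : Fin ω → ℕ) → 1 ≤ ℓ → IsPrimeFactorization ℓ ω p α →
           (n : ℕ) → 1 ≤ n → (𝒜 : List (Subset n)) → IsOddtown ℓ n 𝒜 →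
           ((i j : Fin ω) → Bad n 𝒜 (p i) (p i ^ α i) → Bad n 𝒜 (p j) (p j ^ α j) → i ≡ j)
           ⊎ Bound ω n ℓ (length 𝒜)
lemma3p2 ℓ ω p α 1≤ℓ (primes , p-injective , _ , ℓ≡∏) n _ 𝒜 (_ , ℓ∤size , ℓ∣intersection)
  with unique-or-twoDistinct (λ k → Bad? n 𝒜 (p k) (p k ^ α k))
... | inj₁ atMostOneBad = inj₁ atMostOneBad
... | inj₂ (i , j , i≢j , (_ , fewColumns) , _) =
  inj₂ (bound-from-columnCount ω n ℓ (length 𝒜) _ 1≤ωℓ fewColumns
         (length+n≤ {α = α} primes p-injective ℓ≡∏ ℓ∤size ℓ∣intersection i≢j))
  where
  1≤ωℓ = ℕP.*-mono-≤ (ℕ.>-nonZero⁻¹ ω {{FinP.nonZeroIndex i}}) 1≤ℓ
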